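{- Let $M$ be a vertically $4$-connected matroid. Let $X \subseteq E(M)$ and $x \in X$. If $M|X$ is isomorphic to $U_{2,4}$ or to $U_{2,4} \oplus_2 U_{2,4}$, then $M \setminus x$ is vertically $4$-connected.
   Context: For a matroid $M$ with ground set $E$ and rank function $r$, the connectivity function is $\lambda_M(X) = r(X) + r(E-X) - r(M)$. For a positive integer $j$, a partition $(X,Y)$ of $E$ is a vertical $j$-separation of $M$ if $\lambda_M(X) < j$ and $\min\{r(X), r(Y)\} \ge j$. For an integer $k \ge 2$, $M$ is vertically $k$-connected if it has no vertical $j$-separation with $j < k$. $M|X$ is the restriction of $M$ to $X$, $U_{2,4}$ is the rank-$2$ uniform matroid on $4$ elements, and $\oplus_2$ denotes the $2$-sum (so $U_{2,4} \oplus_2 U_{2,4}$ is the rank-$3$ matroid on $6$ elements consisting of two disjoint triangles spanning a common plane, i.e., two $4$-point lines sharing a deleted basepoint). -}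

module Defs where

open import Data.Nat using (ℕ; zero; suc; _+_; _∸_; _≤_; _<_; _⊓_)
open import Data.Bool using (Bool; true; false; if_then_else_)
import Data.Bool.Properties as BoolP
open import Data.Fin using (Fin; zero; suc)
open import Data.Fin.Subset using (Subset; outside; inside; ⊤; ⊥; ⁅_⁆; _∈_; _⊆_; ∁; _∪_; _∩_; ∣_∣)
open import Data.Vec using (Vec; []; _∷_)
open import Data.Vec.Properties using (≡-dec)
open import Data.Product using (Σ; ∃; _×_; _,_)
open import Relation.Nullary using (¬_; Dec; yes; no)
open import Relation.Binary.PropositionalEquality using (_≡_)
open import Function.Definitions using (Injective)

record Matroid (n : ℕ) : Set where
  field
    rank        : Subset n → ℕ
    rank-≤-card : ∀ A → rank A ≤ ∣ A ∣
    rank-mono   : ∀ {A B} → A ⊆ B → rank A ≤ rank B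
    rank-submod : ∀ A B → rank (A ∪ B) + rank (A ∩ B) ≤ rank A + rank B
open Matroid public

-- We work with the restriction M|S of M to a ground subset S ⊆ E(M);
-- its rank function is that of M on subsets of S.  In particular
-- M itself is M|⊤ and the deletion M \ x is M|(E - {x}) = M|(∁ ⁅ x ⁆).

conn : ∀ {n} → Matroid n → Subset n → Subset n → ℕ
conn M S X = rank M X + rank M (S ∩ ∁ X) ∸ rank M S

VerticalSep : ∀ {n} → Matroid n → Subset n → ℕ → Subset n → Set
VerticalSep M S j X =
  X ⊆ S × conn M S X < j × j ≤ rank M X × j ≤ rank M (S ∩ ∁ X)

VertConn : ∀ {n} → Matroid n → Subset n → ℕ → Set
VertConn M S k = ∀ j → 1 ≤ j → j < k → ¬ (∃ λ X → VerticalSep M S j X)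

image : ∀ {m n} → (Fin m → Fin n) → Subset m → Subset n
image {zero}  f []          = ⊥
image {suc m} f (b ∷ A) =
  (if b then ⁅ f zero ⁆ else ⊥) ∪ image (λ i → f (suc i)) A

RestrIso : ∀ {n} → Matroid n → Subset n → (m : ℕ) → (Subset m → ℕ) → Set
RestrIso {n} M X m rk =
  Σ (Fin m → Fin n) λ f →
    Injective _≡_ _≡_ f × image f ⊤ ≡ X × (∀ A → rank M (image f A) ≡ rk A)

rankU24 : Subset 4 → ℕ
rankU24 A = ∣ A ∣ ⊓ 2

-- Rank function of U_{2,4} ⊕₂ U_{2,4}: rank-3 matroid on 6 elements whose
-- only non-trivial flats of rank 2 are the two disjoint 3-point lines
-- {0,1,2} and {3,4,5}.
line₁ line₂ : Subset 6
line₁ = inside ∷ inside ∷ inside ∷ outside ∷ outside ∷ outside ∷ []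
line₂ = outside ∷ outside ∷ outside ∷ inside ∷ inside ∷ inside ∷ []

rankU24⊕₂U24 : Subset 6 → ℕ
rankU24⊕₂U24 A with ≡-dec BoolP._≟_ A line₁ | ≡-dec BoolP._≟_ A line₂
... | yes _ | _     = 2
... | no _  | yes _ = 2
... | no _  | no _  = ∣ A ∣ ⊓ 3

{-# OPTIONS --safe #-}
module Submission where

-- Let (A, B) be a vertical j-separation of M \ x with j ≤ 3.  Each element of U₂,₄ and
-- of U₂,₄ ⊕₂ U₂,₄ is spanned by one side of every 2-colouring of the other elements, so
-- transporting the colouring induced by (A, B) into the copy of that matroid through x
-- shows that x is spanned by A or by B.  Adding x to that side does not change its rank,
-- so (A ∪ x, B) or (A, B ∪ x) is a vertical j-separation of M, which is impossible.

open import Defs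
open import Data.Nat using (ℕ; _≤_; _≤?_; _+_)
open import Data.Nat.Properties using (≤-trans; ≤-<-trans; +-mono-≤; +-monoʳ-≤; +-cancelʳ-≤; ∸-mono; ∸-monoˡ-≤; +-comm; module ≤-Reasoning)
open import Data.Fin using (Fin; zero; suc)
open import Data.Fin.Subset
open import Data.Fin.Subset.Properties
open import Data.Fin.Properties using (all?)
open import Data.Vec using ([]; _∷_; tabulate; lookup; here; there)
open import Data.Vec.Properties using (lookup∘tabulate; []=⇒lookup; lookup⇒[]=)
open import Data.Bool using (true; false)
open import Data.Product using (∃; _×_; _,_; proj₂)
open import Data.Sum using (_⊎_; inj₁; inj₂; [_,_])
open import Data.Empty using (⊥-elim)
open import Function.Base using (_∘_)
open import Relation.Nullary using (Dec; yes; no)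
open import Relation.Nullary.Decidable using (toWitness; _⊎-dec_; ¬?; decidable-stable)
open import Relation.Binary.PropositionalEquality using (_≡_; refl; sym; trans; subst)
open import Function.Definitions using (Injective)

module _ {m : ℕ} (rk : Subset m → ℕ) where

  InClosure : Subset m → Fin m → Set
  InClosure T i = rk (T ∪ ⁅ i ⁆) ≤ rk T

  SpannedBySomeSide : Fin m → Set
  SpannedBySomeSide i =
    ∀ Y → InClosure (∁ ⁅ i ⁆ ∩ Y) i ⊎ InClosure (∁ ⁅ i ⁆ ∩ ∁ Y) i

  private
    someSide? : ∀ i Y → Dec (InClosure (∁ ⁅ i ⁆ ∩ Y) i ⊎ InClosure (∁ ⁅ i ⁆ ∩ ∁ Y) i)
    someSide? i Y = (_ ≤? _) ⊎-dec (_ ≤? _)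

  spannedBySomeSide? : ∀ i → Dec (SpannedBySomeSide i)
  spannedBySomeSide? i with anySubset? (¬? ∘ someSide? i)
  ... | yes (Y , ¬spanned) = no λ spanned → ¬spanned (spanned Y)
  ... | no ¬counterexample = yes λ Y → decidable-stable (someSide? i Y) (¬counterexample ∘ (Y ,_))

module _ {n : ℕ} (M : Matroid n) where

  InClosure-mono : ∀ {T Y x} → T ⊆ Y → InClosure (rank M) T x → InClosure (rank M) Y x
  InClosure-mono {T} {Y} {x} T⊆Y x∈clT = +-cancelʳ-≤ (rank M T) _ _ (begin
    rank M (Y ∪ ⁅ x ⁆) + rank M T
      ≤⟨ +-mono-≤ (rank-mono M Yx⊆) (rank-mono M T⊆) ⟩
    rank M (Y ∪ (T ∪ ⁅ x ⁆)) + rank M (Y ∩ (T ∪ ⁅ x ⁆))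
      ≤⟨ rank-submod M Y (T ∪ ⁅ x ⁆) ⟩
    rank M Y + rank M (T ∪ ⁅ x ⁆)
      ≤⟨ +-monoʳ-≤ (rank M Y) x∈clT ⟩
    rank M Y + rank M T ∎)
    where
    open ≤-Reasoning
    Yx⊆ : Y ∪ ⁅ x ⁆ ⊆ Y ∪ (T ∪ ⁅ x ⁆)
    Yx⊆ z∈ with x∈p∪q⁻ Y ⁅ x ⁆ z∈
    ... | inj₁ z∈Y = x∈p∪q⁺ (inj₁ z∈Y)
    ... | inj₂ z∈x = x∈p∪q⁺ (inj₂ (q⊆p∪q T ⁅ x ⁆ z∈x))
    T⊆ : T ⊆ Y ∩ (T ∪ ⁅ x ⁆)
    T⊆ z∈T = x∈p∩q⁺ (T⊆Y z∈T , p⊆p∪q ⁅ x ⁆ z∈T)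

  VerticalSep-swap : ∀ {S j Y} → VerticalSep M S j Y → VerticalSep M S j (S ∩ ∁ Y)
  VerticalSep-swap {S} {j} {Y} (Y⊆S , conn<j , j≤rY , j≤rZ) =
    p∩q⊆p S Z , ≤-<-trans conn≤ conn<j , j≤rZ , ≤-trans j≤rY (rank-mono M Y⊆)
    where
    Z = ∁ Y
    open ≤-Reasoning
    ⊆Y : S ∩ ∁ (S ∩ Z) ⊆ Y
    ⊆Y z∈ with x∈p∩q⁻ S (∁ (S ∩ Z)) z∈
    ... | z∈S , z∉S∩Z = x∉∁p⇒x∈p λ z∈Z → x∈∁p⇒x∉p z∉S∩Z (x∈p∩q⁺ (z∈S , z∈Z))
    Y⊆ : Y ⊆ S ∩ ∁ (S ∩ Z)
    Y⊆ z∈Y = x∈p∩q⁺ (Y⊆S z∈Y , x∉p⇒x∈∁p λ z∈S∩Z → x∈∁p⇒x∉p (proj₂ (x∈p∩q⁻ S Z z∈S∩Z)) z∈Y)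
    conn≤ : conn M S (S ∩ Z) ≤ conn M S Y
    conn≤ = ∸-monoˡ-≤ (rank M S) (begin
      rank M (S ∩ Z) + rank M (S ∩ ∁ (S ∩ Z)) ≤⟨ +-monoʳ-≤ (rank M (S ∩ Z)) (rank-mono M ⊆Y) ⟩
      rank M (S ∩ Z) + rank M Y                ≡⟨ +-comm (rank M (S ∩ Z)) (rank M Y) ⟩
      rank M Y + rank M (S ∩ Z)                ∎)

  VerticalSep-addSpanned : ∀ {x j Y} → VerticalSep M (∁ ⁅ x ⁆) j Y → InClosure (rank M) Y x →
    VerticalSep M ⊤ j (Y ∪ ⁅ x ⁆)
  VerticalSep-addSpanned {x} {j} {Y} (_ , conn<j , j≤rY , j≤rZ) x∈clY =
    ⊆⊤ , ≤-<-trans conn≤ conn<j ,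
    ≤-trans j≤rY (rank-mono M (p⊆p∪q ⁅ x ⁆)) , ≤-trans j≤rZ (rank-mono M Z⊆)
    where
    Z⊆ : ∁ ⁅ x ⁆ ∩ ∁ Y ⊆ ⊤ ∩ ∁ (Y ∪ ⁅ x ⁆)
    Z⊆ z∈ with x∈p∩q⁻ (∁ ⁅ x ⁆) (∁ Y) z∈
    ... | z∉x , z∉Y = x∈p∩q⁺ (∈⊤ , x∉p⇒x∈∁p ([ x∈∁p⇒x∉p z∉Y , x∈∁p⇒x∉p z∉x ] ∘ x∈p∪q⁻ Y ⁅ x ⁆))
    ⊆Z : ⊤ ∩ ∁ (Y ∪ ⁅ x ⁆) ⊆ ∁ ⁅ x ⁆ ∩ ∁ Y
    ⊆Z z∈ with x∈∁p⇒x∉p (proj₂ (x∈p∩q⁻ ⊤ (∁ (Y ∪ ⁅ x ⁆)) z∈))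
    ... | z∉Yx = x∈p∩q⁺ (x∉p⇒x∈∁p (z∉Yx ∘ q⊆p∪q Y ⁅ x ⁆) , x∉p⇒x∈∁p (z∉Yx ∘ p⊆p∪q ⁅ x ⁆))
    conn≤ : conn M ⊤ (Y ∪ ⁅ x ⁆) ≤ conn M (∁ ⁅ x ⁆) Y
    conn≤ = ∸-mono (+-mono-≤ x∈clY (rank-mono M ⊆Z)) (rank-mono M ⊆⊤)

  deletion-vertConn : ∀ {k x} → VertConn M ⊤ k → SpannedBySomeSide (rank M) x →
    VertConn M (∁ ⁅ x ⁆) k
  deletion-vertConn vc spanned j 1≤j j<k (Y , sep) with spanned Y
  ... | inj₁ x∈cl = vc j 1≤j j<k
    (_ , VerticalSep-addSpanned sep (InClosure-mono (p∩q⊆q _ Y) x∈cl))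
  ... | inj₂ x∈cl = vc j 1≤j j<k
    (_ , VerticalSep-addSpanned (VerticalSep-swap sep) x∈cl)

image-∈⁺ : ∀ {m n} (f : Fin m → Fin n) {T k} → k ∈ T → f k ∈ image f T
image-∈⁺ f here        = x∈p∪q⁺ (inj₁ (x∈⁅x⁆ (f zero)))
image-∈⁺ f (there k∈T) = x∈p∪q⁺ (inj₂ (image-∈⁺ (f ∘ suc) k∈T))

image-∈⁻ : ∀ {m n} (f : Fin m → Fin n) (T : Subset m) {z} → z ∈ image f T →
  ∃ λ k → k ∈ T × f k ≡ z
image-∈⁻ f []      z∈ = ⊥-elim (∉⊥ z∈)
image-∈⁻ f (b ∷ T) z∈ with b | x∈p∪q⁻ _ (image (f ∘ suc) T) z∈
... | true  | inj₁ z∈fzero = zero , here , sym (x∈⁅y⁆⇒x≡y (f zero) z∈fzero)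
... | false | inj₁ z∈∅     = ⊥-elim (∉⊥ z∈∅)
... | _     | inj₂ z∈image with image-∈⁻ (f ∘ suc) T z∈image
...   | k , k∈T , fk≡z = suc k , there k∈T , fk≡z

image-mono : ∀ {m n} (f : Fin m → Fin n) {T U} → T ⊆ U → image f T ⊆ image f U
image-mono f {T} T⊆U z∈ with image-∈⁻ f T z∈
... | k , k∈T , refl = image-∈⁺ f (T⊆U k∈T)

preimage : ∀ {m n} → (Fin m → Fin n) → Subset n → Subset m
preimage f Y = tabulate (lookup Y ∘ f)

module _ {m n : ℕ} (f : Fin m → Fin n) {Y : Subset n} {k : Fin m} where

  ∈-preimage⁻ : k ∈ preimage f Y → f k ∈ Y
  ∈-preimage⁻ k∈ = lookup⇒[]= (f k) Y (trans (sym (lookup∘tabulate (lookup Y ∘ f) k)) ([]=⇒lookup k∈))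

  ∈-preimage⁺ : f k ∈ Y → k ∈ preimage f Y
  ∈-preimage⁺ fk∈ = lookup⇒[]= k (preimage f Y) (trans (lookup∘tabulate (lookup Y ∘ f) k) ([]=⇒lookup fk∈))

  ∈-∁preimage⁻ : k ∈ ∁ (preimage f Y) → f k ∈ ∁ Y
  ∈-∁preimage⁻ k∈ = x∉p⇒x∈∁p (x∈∁p⇒x∉p k∈ ∘ ∈-preimage⁺)

image-InClosure : ∀ {m n} (M : Matroid n) {rk : Subset m → ℕ} (f : Fin m → Fin n) →
  (∀ A → rank M (image f A) ≡ rk A) →
  ∀ {T i} → InClosure rk T i → InClosure (rank M) (image f T) (f i)
image-InClosure M {rk} f rank-f {T} {i} i∈clT = begin
  rank M (image f T ∪ ⁅ f i ⁆)  ≤⟨ rank-mono M image-∪⁅⁆ ⟩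
  rank M (image f (T ∪ ⁅ i ⁆))  ≡⟨ rank-f (T ∪ ⁅ i ⁆) ⟩
  rk (T ∪ ⁅ i ⁆)                ≤⟨ i∈clT ⟩
  rk T                          ≡⟨ sym (rank-f T) ⟩
  rank M (image f T)            ∎
  where
  open ≤-Reasoning
  image-∪⁅⁆ : image f T ∪ ⁅ f i ⁆ ⊆ image f (T ∪ ⁅ i ⁆)
  image-∪⁅⁆ z∈ with x∈p∪q⁻ (image f T) ⁅ f i ⁆ z∈
  ... | inj₁ z∈fT = image-mono f (p⊆p∪q ⁅ i ⁆) z∈fT
  ... | inj₂ z∈fi with x∈⁅y⁆⇒x≡y (f i) z∈fi
  ...   | refl = image-∈⁺ f (q⊆p∪q T ⁅ i ⁆ (x∈⁅x⁆ i))

image-avoiding : ∀ {m n} {f : Fin m → Fin n} → Injective _≡_ _≡_ f → ∀ {i P Y} →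
  (∀ {k} → k ∈ P → f k ∈ Y) → image f (∁ ⁅ i ⁆ ∩ P) ⊆ ∁ ⁅ f i ⁆ ∩ Y
image-avoiding {f = f} f-inj {i} {P} P⇒Y z∈ with image-∈⁻ f (∁ ⁅ i ⁆ ∩ P) z∈
... | k , k∈ , refl with x∈p∩q⁻ (∁ ⁅ i ⁆) P k∈
...   | k∉i , k∈P =
  x∈p∩q⁺ (x∉p⇒x∈∁p (x∉⁅y⁆⇒x≢y (x∈∁p⇒x∉p k∉i) ∘ f-inj ∘ x∈⁅y⁆⇒x≡y (f i)) , P⇒Y k∈P)

RestrIso-SpannedBySomeSide : ∀ {m n} (M : Matroid n) {X : Subset n} {rk : Subset m → ℕ} →
  RestrIso M X m rk → (∀ i → SpannedBySomeSide rk i) →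
  ∀ {x} → x ∈ X → SpannedBySomeSide (rank M) x
RestrIso-SpannedBySomeSide M (f , f-inj , image-f≡X , rank-f) spanned {x} x∈X Y
  with image-∈⁻ f ⊤ (subst (x ∈_) (sym image-f≡X) x∈X)
... | i , _ , refl with spanned i (preimage f Y)
...   | inj₁ i∈cl = inj₁ (InClosure-mono M (image-avoiding f-inj (∈-preimage⁻ f))
                                           (image-InClosure M f rank-f i∈cl))
...   | inj₂ i∈cl = inj₂ (InClosure-mono M (image-avoiding f-inj (∈-∁preimage⁻ f))
                                           (image-InClosure M f rank-f i∈cl))

spannedBySomeSide-U24 : ∀ i → SpannedBySomeSide rankU24 i
spannedBySomeSide-U24 = toWitness {a? = all? (spannedBySomeSide? rankU24)} _

spannedBySomeSide-U24⊕₂U24 : ∀ i → SpannedBySomeSide rankU24⊕₂U24 i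
spannedBySomeSide-U24⊕₂U24 = toWitness {a? = all? (spannedBySomeSide? rankU24⊕₂U24)} _

lemma2p1 : ∀ {n} (M : Matroid n) → VertConn M ⊤ 4 →
    ∀ (X : Subset n) (x : Fin n) → x ∈ X →
    (RestrIso M X 4 rankU24 ⊎ RestrIso M X 6 rankU24⊕₂U24) →
    VertConn M (∁ ⁅ x ⁆) 4
lemma2p1 M vc X x x∈X (inj₁ iso) =
  deletion-vertConn M vc (RestrIso-SpannedBySomeSide M iso spannedBySomeSide-U24 x∈X)
lemma2p1 M vc X x x∈X (inj₂ iso) =
  deletion-vertConn M vc (RestrIso-SpannedBySomeSide M iso spannedBySomeSide-U24⊕₂U24 x∈X)
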